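{- Let $\mathcal A$ be a stable MCS satisfying Condition S. Then $\mathcal A$ is $\pi$-terminating.
   Context: Fix variables $x_1,\dots,x_n$, primed copies $x_i'$. An MC is a conjunction of constraints $x\bowtie y$ ($x,y\in\{x_i,x_i'\}$, ${\bowtie}\in\{>,\ge,=\}$). An MCS $\mathcal A$: a finite directed multigraph on flow-points $F$ with arcs labelled by MCs ($G:f\to g$) and invariants $I_f$ (conjunctions of order constraints among $x_1,\dots,x_n$). States $(f,\sigma)$, $\sigma:\{1..n\}\to\mathbb Z$; for $G:f\to g$, $(f,\sigma)\mapsto(g,\sigma')$ is a transition satisfying $G$ if $\sigma\models I_f$, $\sigma'\models I_g$, $\sigma,\sigma'\models G$. $\pi$-terminating: no infinite run. $G\vdash P$: every transition satisfying $G$ satisfies $P$. MCs are graphs on nodes $x_i,x_i'$ (arc $x\to y$ strict for $x>y$, non-strict for $x\ge y$), identified with their consequence closures. $\mathcal A$ is stable if every MC is satisfiable and for every $G:f\to g$, ${\rhd}\in\{>,\ge\}$: $G\vdash x_i\rhd x_j\Rightarrow I_f\vdash x_i\rhd x_j$ and $G\vdash x_i'\rhd x_j'\Rightarrow I_g\vdash x_i\rhd x_j$. The multipath of a CFG path $f_0\xrightarrow{G_1}f_1\xrightarrow{G_2}\cdots$ is the graph with nodes $x[t,i]$ containing, for each $t\ge1$, the arcs of $G_t$ with $x_i\mapsto x[t-1,i]$, $x_j'\mapsto x[t,j]$. A down-thread is $(x[k,h_k])_{k\ge k_0}$ with arcs $x[k,h_k]\to x[k+1,h_{k+1}]$; an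 up-thread is $(x[k,l_k])_{k\ge k_0}$ with arcs $x[k+1,l_{k+1}]\to x[k,l_k]$. $\mathcal A$ satisfies Condition S if every infinite multipath $M$ contains an infinite down-thread $(x[k,h_k])_{k\ge k_0}$ and infinite up-thread $(x[k,l_k])_{k\ge k_0}$ such that for all $k\ge k_0$ the constraint $x[k,l_k]\le x[k,h_k]$ is present in $M$, and at least one of the two threads has infinitely many strict arcs. -}

module Defs where

open import Data.Nat using (ℕ; zero; suc) renaming (_≤_ to _≤ℕ_)
open import Data.Fin using (Fin)
open import Data.Integer using (ℤ; _>_; _≥_)
open import Data.List using (List)
open import Data.List.Relation.Unary.All using (All)
open import Data.Product using (Σ; ∃; _×_; _,_)
open import Data.Sum using (_⊎_)
open import Relation.Binary.PropositionalEquality using (_≡_)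
open import Relation.Nullary using (¬_)

data Var (n : ℕ) : Set where
  unp : Fin n → Var n
  pr  : Fin n → Var n

data Rel : Set where
  gt ge eq : Rel

data Ord : Set where
  ogt oge : Ord

ordRel : Ord → Rel
ordRel ogt = gt
ordRel oge = ge

⟦_⟧ʳ : Rel → ℤ → ℤ → Set
⟦ gt ⟧ʳ a b = a > b
⟦ ge ⟧ʳ a b = a ≥ b
⟦ eq ⟧ʳ a b = a ≡ b

record Con (n : ℕ) : Set where
  constructor con
  field
    lhs : Var n
    rel : Rel
    rhs : Var n

record ICon (n : ℕ) : Set where
  constructor icon
  field
    ilhs : Fin n
    irel : Rel
    irhs : Fin n

MC : ℕ → Set
MC n = List (Con n)

Inv : ℕ → Set
Inv n = List (ICon n)

Valuation : ℕ → Set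
Valuation n = Fin n → ℤ

val : ∀ {n} → Valuation n → Valuation n → Var n → ℤ
val σ σ' (unp i) = σ i
val σ σ' (pr i)  = σ' i

HoldsC : ∀ {n} → Valuation n → Valuation n → Con n → Set
HoldsC σ σ' (con x r y) = ⟦ r ⟧ʳ (val σ σ' x) (val σ σ' y)

HoldsI : ∀ {n} → Valuation n → ICon n → Set
HoldsI σ (icon i r j) = ⟦ r ⟧ʳ (σ i) (σ j)

SatMC : ∀ {n} → Valuation n → Valuation n → MC n → Set
SatMC σ σ' G = All (HoldsC σ σ') G

SatInv : ∀ {n} → Valuation n → Inv n → Set
SatInv σ I = All (HoldsI σ) I

-- An MCS over variables x_1..x_n: a finite directed multigraph with
-- flow-points Fin nF and arcs Fin nA, each arc labelled by an MC,
-- and an invariant for each flow-point.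
record MCS (n : ℕ) : Set where
  field
    nF    : ℕ
    nA    : ℕ
    src   : Fin nA → Fin nF
    tgt   : Fin nA → Fin nF
    label : Fin nA → MC n
    inv   : Fin nF → Inv n

module _ {n : ℕ} (A : MCS n) where
  open MCS A

  Trans : Fin nA → Valuation n → Valuation n → Set
  Trans e σ σ' = SatInv σ (inv (src e)) × SatInv σ' (inv (tgt e)) × SatMC σ σ' (label e)

  Entails : Fin nA → Con n → Set
  Entails e c = ∀ σ σ' → Trans e σ σ' → HoldsC σ σ' c

  InvEntails : Fin nF → ICon n → Set
  InvEntails f c = ∀ σ → SatInv σ (inv f) → HoldsI σ c

  Stable : Set
  Stable =
    (∀ e → Σ (Valuation n) λ σ → Σ (Valuation n) λ σ' → SatMC σ σ' (label e)) ×
    (∀ e i j (r : Ord) →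
      (Entails e (con (unp i) (ordRel r) (unp j)) → InvEntails (src e) (icon i (ordRel r) j)) ×
      (Entails e (con (pr i) (ordRel r) (pr j)) → InvEntails (tgt e) (icon i (ordRel r) j)))

  record Run : Set where
    field
      fp    : ℕ → Fin nF
      σ     : ℕ → Valuation n
      arc   : ℕ → Fin nA
      src≡  : ∀ t → src (arc t) ≡ fp t
      tgt≡  : ∀ t → tgt (arc t) ≡ fp (suc t)
      trans : ∀ t → Trans (arc t) (σ t) (σ (suc t))

  PiTerminating : Set
  PiTerminating = ¬ Run

  -- An infinite CFG path f_0 -G_1-> f_1 -G_2-> ... ; arc t is G_{t+1}.
  record Path : Set where
    field
      fp   : ℕ → Fin nF
      arc  : ℕ → Fin nA
      src≡ : ∀ t → src (arc t) ≡ fp t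
      tgt≡ : ∀ t → tgt (arc t) ≡ fp (suc t)

  module _ (p : Path) where
    open Path p

    -- Multipath arcs (MCs identified with their consequence closures).
    -- Arc x[k,i] → x[k+1,j] of relation r (present via G_{k+1}).
    DownArc : Rel → ℕ → Fin n → Fin n → Set
    DownArc r k i j = Entails (arc k) (con (unp i) r (pr j))

    -- Arc x[k+1,j] → x[k,i] of relation r (present via G_{k+1}).
    UpArc : Rel → ℕ → Fin n → Fin n → Set
    UpArc r k j i = Entails (arc k) (con (pr j) r (unp i))

    -- The constraint x[k,i] ≥ x[k,j] is present in M (via G_{k+1} on
    -- unprimed variables, or via G_k on primed variables when k ≥ 1).
    LevelGe : ℕ → Fin n → Fin n → Set
    LevelGe zero    i j = Entails (arc zero) (con (unp i) ge (unp j))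
    LevelGe (suc k) i j = Entails (arc (suc k)) (con (unp i) ge (unp j))
                        ⊎ Entails (arc k) (con (pr i) ge (pr j))

  InfinitelyOften : (ℕ → Set) → Set
  InfinitelyOften P = ∀ m → Σ ℕ λ k → m ≤ℕ k × P k

  ConditionS : Set
  ConditionS = ∀ (p : Path) →
    Σ ℕ λ k₀ → Σ (ℕ → Fin n) λ h → Σ (ℕ → Fin n) λ l →
      (∀ k → k₀ ≤ℕ k → DownArc p ge k (h k) (h (suc k))) ×
      (∀ k → k₀ ≤ℕ k → UpArc p ge k (l (suc k)) (l k)) ×
      (∀ k → k₀ ≤ℕ k → LevelGe p k (h k) (l k)) ×
      (InfinitelyOften (λ k → DownArc p gt k (h k) (h (suc k)))
        ⊎ InfinitelyOften (λ k → UpArc p gt k (l (suc k)) (l k)))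

-- Along a run, the values a k of the down-thread never increase, the values b k of the
-- up-thread never decrease, and b k ≤ a k.  Hence the gap a k − b k is a non-negative
-- integer that never increases and, by the strictness in Condition S, drops infinitely
-- often, which is impossible.
module Submission where

open import Defs
open import Data.Nat using (ℕ; zero; suc; _≤′_; ≤′-refl; ≤′-step) renaming (_≤_ to _≤ℕ_; _+_ to _+ℕ_)
import Data.Nat.Properties as ℕ
open import Data.Integer using (ℤ; +_; ∣_∣; _+_; _-_; -_; _≤_; _<_; 0ℤ)
open import Data.Integer.Properties
open import Data.Product using (∃; _×_; _,_; map₂)
open import Data.Sum using (_⊎_; inj₁; inj₂) renaming (map to ⊎-map)
open import Data.Empty using (⊥)
open import Function using (_∘_)
open import Relation.Binary.PropositionalEquality using (refl; sym)
open import Relation.Nullary using (¬_)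

AntitoneFrom : ℕ → (ℕ → ℤ) → Set
AntitoneFrom k₀ Φ = ∀ k → k₀ ≤ℕ k → Φ (suc k) ≤ Φ k

DropsInfinitelyOften : (ℕ → ℤ) → Set
DropsInfinitelyOften Φ = ∀ m → ∃ λ k → m ≤ℕ k × Φ (suc k) < Φ k

antitoneFrom-≤ : ∀ {k₀ m k} {Φ : ℕ → ℤ} → AntitoneFrom k₀ Φ →
                 k₀ ≤ℕ m → m ≤ℕ k → Φ k ≤ Φ m
antitoneFrom-≤ {k₀} {m} {Φ = Φ} anti k₀≤m = go ∘ ℕ.≤⇒≤′
  where
  go : ∀ {k} → m ≤′ k → Φ k ≤ Φ m
  go ≤′-refl = ≤-refl
  go (≤′-step m≤′k) = ≤-trans (anti _ (ℕ.≤-trans k₀≤m (ℕ.≤′⇒≤ m≤′k))) (go m≤′k)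

+-dropsInfinitelyOften : ∀ {k₀} {Φ Ψ : ℕ → ℤ} → AntitoneFrom k₀ Φ → AntitoneFrom k₀ Ψ →
                         DropsInfinitelyOften Φ ⊎ DropsInfinitelyOften Ψ →
                         DropsInfinitelyOften (λ k → Φ k + Ψ k)
+-dropsInfinitelyOften {k₀} antiΦ antiΨ (inj₁ dropsΦ) m =
  let k , m+k₀≤k , drop = dropsΦ (m +ℕ k₀) in
  k , ℕ.m+n≤o⇒m≤o m m+k₀≤k , +-mono-<-≤ drop (antiΨ k (ℕ.m+n≤o⇒n≤o m m+k₀≤k))
+-dropsInfinitelyOften {k₀} antiΦ antiΨ (inj₂ dropsΨ) m =
  let k , m+k₀≤k , drop = dropsΨ (m +ℕ k₀) in
  k , ℕ.m+n≤o⇒m≤o m m+k₀≤k , +-mono-≤-< (antiΦ k (ℕ.m+n≤o⇒n≤o m m+k₀≤k)) drop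

¬-nonNegative-dropsInfinitelyOften : ∀ {k₀} {Φ : ℕ → ℤ} → AntitoneFrom k₀ Φ →
                                     (∀ k → k₀ ≤ℕ k → 0ℤ ≤ Φ k) → ¬ DropsInfinitelyOften Φ
¬-nonNegative-dropsInfinitelyOften {k₀} {Φ} anti nonNeg drops =
  notBelow ∣ Φ k₀ ∣ ℕ.≤-refl (≤-reflexive (sym (0≤i⇒+∣i∣≡i (nonNeg k₀ ℕ.≤-refl))))
  where
  smallerLater : ∀ {m} → k₀ ≤ℕ m → ∃ λ m′ → k₀ ≤ℕ m′ × Φ m′ < Φ m
  smallerLater {m} k₀≤m =
    let k , m≤k , drop = drops m
        k₀≤k = ℕ.≤-trans k₀≤m m≤k
    in suc k , ℕ.m≤n⇒m≤1+n k₀≤k , <-≤-trans drop (antitoneFrom-≤ anti k₀≤m m≤k)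

  notBelow : ∀ N {m} → k₀ ≤ℕ m → Φ m ≤ + N → ⊥
  notBelow zero k₀≤m Φm≤0 =
    let m′ , k₀≤m′ , smaller = smallerLater k₀≤m
    in <-irrefl refl (≤-<-trans (nonNeg m′ k₀≤m′) (<-≤-trans smaller Φm≤0))
  notBelow (suc N) k₀≤m Φm≤1+N =
    let m′ , k₀≤m′ , smaller = smallerLater k₀≤m
    in notBelow N k₀≤m′ (i<j⇒i≤pred[j] (<-≤-trans smaller Φm≤1+N))

module _ {n : ℕ} (A : MCS n) (run : Run A) where
  open Run run

  runPath : Path A
  runPath = record { fp = fp ; arc = arc ; src≡ = src≡ ; tgt≡ = tgt≡ }

  downArc-holds : ∀ {r k i j} → DownArc A runPath r k i j → ⟦ r ⟧ʳ (σ k i) (σ (suc k) j)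
  downArc-holds {k = k} downArc = downArc (σ k) (σ (suc k)) (trans k)

  upArc-holds : ∀ {r k j i} → UpArc A runPath r k j i → ⟦ r ⟧ʳ (σ (suc k) j) (σ k i)
  upArc-holds {k = k} upArc = upArc (σ k) (σ (suc k)) (trans k)

  levelGe-holds : ∀ {k i j} → LevelGe A runPath k i j → σ k j ≤ σ k i
  levelGe-holds {zero}  unprimed        = unprimed (σ 0) (σ 1) (trans 0)
  levelGe-holds {suc k} (inj₁ unprimed) = unprimed (σ (suc k)) (σ (suc (suc k))) (trans (suc k))
  levelGe-holds {suc k} (inj₂ primed)   = primed (σ k) (σ (suc k)) (trans k)

mainTheorem5 : ∀ {n : ℕ} (A : MCS n) → Stable A → ConditionS A → PiTerminating A
mainTheorem5 A _ conditionS run with conditionS (runPath A run)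
... | k₀ , h , l , down , up , level , strict =
  ¬-nonNegative-dropsInfinitelyOften gap-antitone gap-nonNeg
    (+-dropsInfinitelyOften a-antitone -b-antitone a-or--b-drops)
  where
  open Run run using (σ)

  a b : ℕ → ℤ
  a k = σ k (h k)
  b k = σ k (l k)

  a-antitone : AntitoneFrom k₀ a
  a-antitone k k₀≤k = downArc-holds A run (down k k₀≤k)

  -b-antitone : AntitoneFrom k₀ (-_ ∘ b)
  -b-antitone k k₀≤k = neg-mono-≤ (upArc-holds A run (up k k₀≤k))

  gap-antitone : AntitoneFrom k₀ (λ k → a k - b k)
  gap-antitone k k₀≤k = +-mono-≤ (a-antitone k k₀≤k) (-b-antitone k k₀≤k)

  gap-nonNeg : ∀ k → k₀ ≤ℕ k → 0ℤ ≤ a k - b k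
  gap-nonNeg k k₀≤k = i≤j⇒0≤j-i (levelGe-holds A run (level k k₀≤k))

  a-or--b-drops : DropsInfinitelyOften a ⊎ DropsInfinitelyOften (-_ ∘ b)
  a-or--b-drops = ⊎-map (map₂ (map₂ (downArc-holds A run)) ∘_)
                        (map₂ (map₂ (neg-mono-< ∘ upArc-holds A run)) ∘_)
                        strict
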